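{- For all integers $n\geq m\geq 2$, \[ f(m,n)=\mathrm{Sur}(m-1,n)-\mathrm{Sur}(m-2,n)+\dots+(-1)^m\,\mathrm{Sur}(1,n)=\sum_{k=1}^{m-1}(-1)^{m-1-k}\,\mathrm{Sur}(k,n), \] where $f(m,n)=\sum_{\alpha=1}^{m-1}(-1)^{m+\alpha+1}\binom{m}{\alpha+1}\alpha^n$.
   Context: For positive integers $a,b$, $\mathrm{Sur}(a,b)$ denotes the number of surjective functions from $\{1,\dots,b\}$ to $\{1,\dots,a\}$ (equivalently $a!$ times the Stirling number of the second kind $S(b,a)$). -}

module Defs where

open import Data.Nat using (ℕ; zero; suc; _^_)
open import Data.Nat.Combinatorics using (_C_)
open import Data.Integer using (ℤ; +_; -_; _+_; _*_)
open import Data.Fin using (Fin)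
open import Data.Vec using (Vec; []; _∷_; lookup)
open import Data.List using (List; []; _∷_; map; concatMap; allFin; filter; length)
open import Data.Fin.Properties using (any?)
open import Data.List.Membership.DecPropositional using ()
open import Relation.Binary.PropositionalEquality using (_≡_)
open import Data.Product using (∃)
open import Relation.Nullary using (Dec)

-- all functions Fin b → Fin a, represented as vectors of values (tables)
allFuns : (a b : ℕ) → List (Vec (Fin a) b)
allFuns a zero = [] ∷ []
allFuns a (suc b) = concatMap (λ v → map (λ i → i ∷ v) (allFin a)) (allFuns a b)

Surjective : {a b : ℕ} → Vec (Fin a) b → Set
Surjective {a} {b} f = (y : Fin a) → ∃ λ (x : Fin b) → lookup f x ≡ y

surjective? : {a b : ℕ} → (f : Vec (Fin a) b) → Dec (Surjective f)
surjective? {a} {b} f = Data.Fin.Properties.all? λ y → any? λ x → lookup f x Data.Fin.≟ y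
  where import Data.Fin

Sur : ℕ → ℕ → ℕ
Sur a b = length (filter surjective? (allFuns a b))

sign : ℕ → ℤ
sign zero = + 1
sign (suc k) = - sign k

sumFrom1 : ℕ → (ℕ → ℤ) → ℤ
sumFrom1 zero g = + 0
sumFrom1 (suc N) g = sumFrom1 N g + g (suc N)

f : ℕ → ℕ → ℤ
f m n = sumFrom1 (m Data.Nat.∸ 1) (λ α → sign (m Data.Nat.+ α Data.Nat.+ 1) * + ((m C (suc α)) Data.Nat.* (α ^ n)))
  where import Data.Nat

{-# OPTIONS --safe #-}
-- Sort the tables of the functions Fin n → Fin a by the size of their image: prepending a
-- value to a table whose image has h elements keeps that size in h ways and raises it in
-- a ∸ h ways. Iterating this transition n times on the indicator of size a, and solving the
-- resulting recursion by finite differences of x ↦ x^n, gives inclusion-exclusion: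
-- Sur(a,n) = Σ_t (-1)^(a-t) C(a,t) t^n. Substituted into Σ_k (-1)^(m-1-k) Sur(k,n), Pascal's
-- rule C(k+1,t+1) = C(k,t) + C(k,t+1) telescopes the sum over k into C(m,t+1), which is f(m,n).
module Submission where

open import Defs
open import Data.Nat as ℕ using (ℕ; zero; suc; _≤_; _∸_; _^_; _≟_)
import Data.Nat.Properties as ℕ
open import Data.Nat.Combinatorics using (_C_; k>n⇒nCk≡0; nC1≡n; nCk+nC[k+1]≡[n+1]C[k+1])
open import Data.Nat.GeneralisedArithmetic using (fold; iterate; iterate-is-fold)
open import Data.Nat.ListAction using (sum)
open import Data.Nat.ListAction.Properties using (sum-++)
open import Data.Nat.Tactic.RingSolver using () renaming (solve-∀ to solve-ℕ)
open import Data.Integer using (ℤ; +_; -_; _+_; _-_; _*_)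
import Data.Integer.Properties as ℤ
open import Data.Integer.Tactic.RingSolver using (solve-∀)
open import Data.Bool using (true; false; if_then_else_)
open import Data.Fin using (Fin; zero; suc)
open import Data.Fin.Subset using (Subset; inside; outside; ⊥; ⊤; ⁅_⁆; _∪_; ∣_∣; _∈_)
open import Data.Fin.Subset.Properties
  using (∣p∣≤n; ∣⊤∣≡n; ∣⊥∣≡0; ∣p∣≡n⇒p≡⊤; ∈⊤; ⊆⊤; ⊆-antisym; ∪-identityˡ;
         x∈p∪q⁺; x∈p∪q⁻; x∈⁅x⁆; x∈⁅y⁆⇒x≡y; ∉⊥)
open import Data.Vec using (Vec; []; _∷_; lookup)
open import Data.List using (List; []; _∷_; map; concatMap; allFin; filter; length; tabulate; _++_)
import Data.List.Properties as List
open import Data.Product using (∃; _,_)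
open import Data.Sum using (inj₁; inj₂)
open import Function using (_∘_)
open import Relation.Nullary using (does; contradiction)
open import Relation.Nullary.Decidable using (dec-true; dec-false)
open import Relation.Unary using (Pred; Decidable)
open import Relation.Binary.PropositionalEquality

[1+k]*[1+n]C[1+k]≡[1+n]*nCk : ∀ n k → suc k ℕ.* (suc n C suc k) ≡ suc n ℕ.* (n C k)
[1+k]*[1+n]C[1+k]≡[1+n]*nCk n       zero    =
  trans (ℕ.*-identityˡ (suc n C 1)) (trans (nC1≡n (suc n)) (sym (ℕ.*-identityʳ (suc n))))
[1+k]*[1+n]C[1+k]≡[1+n]*nCk zero    (suc k) =
  trans (cong (suc (suc k) ℕ.*_) (k>n⇒nCk≡0 {1} {suc (suc k)} (ℕ.s≤s ℕ.z<s))) (ℕ.*-zeroʳ (suc (suc k)))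
[1+k]*[1+n]C[1+k]≡[1+n]*nCk (suc n) (suc k) = begin
  suc (suc k) ℕ.* (suc (suc n) C suc (suc k))
    ≡⟨ cong (suc (suc k) ℕ.*_) (nCk+nC[k+1]≡[n+1]C[k+1] (suc n) (suc k)) ⟨
  suc (suc k) ℕ.* (suc n C suc k ℕ.+ suc n C suc (suc k))
    ≡⟨ distrib (suc k) (suc n C suc k) (suc n C suc (suc k)) ⟩
  suc k ℕ.* (suc n C suc k) ℕ.+ suc n C suc k ℕ.+ suc (suc k) ℕ.* (suc n C suc (suc k))
    ≡⟨ cong₂ (λ x y → x ℕ.+ suc n C suc k ℕ.+ y)
             ([1+k]*[1+n]C[1+k]≡[1+n]*nCk n k) ([1+k]*[1+n]C[1+k]≡[1+n]*nCk n (suc k)) ⟩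
  suc n ℕ.* (n C k) ℕ.+ suc n C suc k ℕ.+ suc n ℕ.* (n C suc k)
    ≡⟨ collect (suc n) (n C k) (n C suc k) (suc n C suc k) ⟩
  suc n ℕ.* (n C k ℕ.+ n C suc k) ℕ.+ suc n C suc k
    ≡⟨ cong (λ x → suc n ℕ.* x ℕ.+ suc n C suc k) (nCk+nC[k+1]≡[n+1]C[k+1] n k) ⟩
  suc n ℕ.* (suc n C suc k) ℕ.+ suc n C suc k
    ≡⟨ ℕ.+-comm (suc n ℕ.* (suc n C suc k)) _ ⟩
  suc (suc n) ℕ.* (suc n C suc k) ∎
  where
  open ≡-Reasoning
  distrib : ∀ k x y → suc k ℕ.* (x ℕ.+ y) ≡ k ℕ.* x ℕ.+ x ℕ.+ suc k ℕ.* y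
  distrib = solve-ℕ
  collect : ∀ m x y z → m ℕ.* x ℕ.+ z ℕ.+ m ℕ.* y ≡ m ℕ.* (x ℕ.+ y) ℕ.+ z
  collect = solve-ℕ

sumFrom0 : ℕ → (ℕ → ℤ) → ℤ
sumFrom0 n g = g 0 + sumFrom1 n g

sumFrom1-cong : ∀ n {g h : ℕ → ℤ} → (∀ t → t ≤ n → g t ≡ h t) → sumFrom1 n g ≡ sumFrom1 n h
sumFrom1-cong zero    eq = refl
sumFrom1-cong (suc n) eq =
  cong₂ _+_ (sumFrom1-cong n (λ t t≤n → eq t (ℕ.m≤n⇒m≤1+n t≤n))) (eq (suc n) ℕ.≤-refl)

sumFrom1-+ : ∀ n (g h : ℕ → ℤ) → sumFrom1 n (λ t → g t + h t) ≡ sumFrom1 n g + sumFrom1 n h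
sumFrom1-+ zero    g h = refl
sumFrom1-+ (suc n) g h = trans (cong (_+ (g (suc n) + h (suc n))) (sumFrom1-+ n g h))
                               (interchange (sumFrom1 n g) (sumFrom1 n h) (g (suc n)) (h (suc n)))
  where
  interchange : ∀ a b c d → (a + b) + (c + d) ≡ (a + c) + (b + d)
  interchange = solve-∀

+-−-interchange : ∀ a b c d → (a - b) + (c - d) ≡ (a + c) - (b + d)
+-−-interchange = solve-∀

sumFrom1-- : ∀ n (g h : ℕ → ℤ) → sumFrom1 n (λ t → g t - h t) ≡ sumFrom1 n g - sumFrom1 n h
sumFrom1-- zero    g h = refl
sumFrom1-- (suc n) g h = trans (cong (_+ (g (suc n) - h (suc n))) (sumFrom1-- n g h))
                               (+-−-interchange (sumFrom1 n g) (sumFrom1 n h) (g (suc n)) (h (suc n)))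

sumFrom1-*ˡ : ∀ n c (g : ℕ → ℤ) → sumFrom1 n (λ t → c * g t) ≡ c * sumFrom1 n g
sumFrom1-*ˡ zero    c g = sym (ℤ.*-zeroʳ c)
sumFrom1-*ˡ (suc n) c g = trans (cong (_+ c * g (suc n)) (sumFrom1-*ˡ n c g)) (sym (ℤ.*-distribˡ-+ c _ _))

sumFrom1-shift : ∀ n (g : ℕ → ℤ) → sumFrom1 (suc n) g ≡ sumFrom0 n (g ∘ suc)
sumFrom1-shift zero    g = ℤ.+-comm (+ 0) (g 1)
sumFrom1-shift (suc n) g = trans (cong (_+ g (suc (suc n))) (sumFrom1-shift n g)) (ℤ.+-assoc (g 1) _ _)

sumFrom0-- : ∀ n (g h : ℕ → ℤ) → sumFrom0 n (λ t → g t - h t) ≡ sumFrom0 n g - sumFrom0 n h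
sumFrom0-- n g h = trans (cong (_+_ (g 0 - h 0)) (sumFrom1-- n g h))
                         (+-−-interchange (g 0) (h 0) (sumFrom1 n g) (sumFrom1 n h))

sumFrom0-*ˡ : ∀ n c (g : ℕ → ℤ) → sumFrom0 n (λ t → c * g t) ≡ c * sumFrom0 n g
sumFrom0-*ˡ n c g = trans (cong (_+_ (c * g 0)) (sumFrom1-*ˡ n c g)) (sym (ℤ.*-distribˡ-+ c _ _))

sumFrom0-cong : ∀ n {g h : ℕ → ℤ} → (∀ t → g t ≡ h t) → sumFrom0 n g ≡ sumFrom0 n h
sumFrom0-cong n eq = cong₂ _+_ (eq 0) (sumFrom1-cong n (λ t _ → eq t))

sign-+ : ∀ a b → sign (a ℕ.+ b) ≡ sign a * sign b
sign-+ zero    b = sym (ℤ.*-identityˡ (sign b))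
sign-+ (suc a) b = trans (cong -_ (sign-+ a b)) (ℤ.neg-distribˡ-* (sign a) (sign b))

sign-∸ : ∀ {k K} → k ≤ K → sign K ≡ sign (K ∸ k) * sign k
sign-∸ {k} {K} k≤K = trans (cong sign (sym (ℕ.m∸n+n≡m k≤K))) (sign-+ (K ∸ k) k)

alternatingSum-pascal : ∀ (c d : ℕ → ℤ) → d 0 ≡ c 0 → (∀ t → d (suc t) ≡ c t + c (suc t)) →
                         ∀ N → sumFrom0 N (λ t → sign t * d t) ≡ sign N * c N
alternatingSum-pascal c d d0 dsuc zero    = trans (ℤ.+-identityʳ _) (cong (+ 1 *_) d0)
alternatingSum-pascal c d d0 dsuc (suc N) = begin
  sign 0 * d 0 + (sumFrom1 N (λ t → sign t * d t) + sign (suc N) * d (suc N))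
    ≡⟨ ℤ.+-assoc (sign 0 * d 0) _ _ ⟨
  sumFrom0 N (λ t → sign t * d t) + sign (suc N) * d (suc N)
    ≡⟨ cong₂ (λ x y → x + sign (suc N) * y) (alternatingSum-pascal c d d0 dsuc N) (dsuc N) ⟩
  sign N * c N + (- sign N) * (c N + c (suc N))
    ≡⟨ cancel (sign N) (c N) (c (suc N)) ⟩
  sign (suc N) * c (suc N) ∎
  where
  open ≡-Reasoning
  cancel : ∀ s x y → s * x + (- s) * (x + y) ≡ (- s) * y
  cancel = solve-∀

alternatingSum-binomial≡0 : ∀ r → sumFrom0 (suc r) (λ t → sign t * + (suc r C t)) ≡ + 0
alternatingSum-binomial≡0 r = begin
  sumFrom0 (suc r) (λ t → sign t * + (suc r C t))
    ≡⟨ alternatingSum-pascal (λ t → + (r C t)) (λ t → + (suc r C t)) refl pascal (suc r) ⟩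
  sign (suc r) * + (r C suc r)
    ≡⟨ cong (λ x → sign (suc r) * + x) (k>n⇒nCk≡0 (ℕ.n<1+n r)) ⟩
  sign (suc r) * + 0
    ≡⟨ ℤ.*-zeroʳ (sign (suc r)) ⟩
  + 0 ∎
  where
  open ≡-Reasoning
  pascal : ∀ t → + (suc r C suc t) ≡ + (r C t) + + (r C suc t)
  pascal t = trans (cong +_ (sym (nCk+nC[k+1]≡[n+1]C[k+1] r t))) (ℤ.pos-+ (r C t) _)

-- altBinomialSum r h n is (-1)^r times the r-th forward difference of x ↦ x^n at h.
altBinomialTerm : ℕ → ℕ → ℕ → ℕ → ℤ
altBinomialTerm r h n t = sign t * + ((r C t) ℕ.* (h ℕ.+ t) ^ n)

altBinomialSum : ℕ → ℕ → ℕ → ℤ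
altBinomialSum r h n = sumFrom0 r (altBinomialTerm r h n)

altBinomialSum[0,h,n]≡h^n : ∀ h n → altBinomialSum 0 h n ≡ + (h ^ n)
altBinomialSum[0,h,n]≡h^n h n = begin
  + 1 * + (1 ℕ.* (h ℕ.+ 0) ^ n) + + 0 ≡⟨ ℤ.+-identityʳ _ ⟩
  + 1 * + (1 ℕ.* (h ℕ.+ 0) ^ n)       ≡⟨ ℤ.*-identityˡ _ ⟩
  + (1 ℕ.* (h ℕ.+ 0) ^ n)             ≡⟨ cong +_ (ℕ.*-identityˡ _) ⟩
  + ((h ℕ.+ 0) ^ n)                   ≡⟨ cong (λ x → + (x ^ n)) (ℕ.+-identityʳ h) ⟩
  + (h ^ n)                           ∎
  where open ≡-Reasoning

altBinomialSum[1+r,h,0]≡0 : ∀ r h → altBinomialSum (suc r) h 0 ≡ + 0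
altBinomialSum[1+r,h,0]≡0 r h =
  trans (sumFrom0-cong (suc r) (λ t → cong (λ x → sign t * + x) (ℕ.*-identityʳ (suc r C t))))
        (alternatingSum-binomial≡0 r)

altBinomialSum-recurrence : ∀ r h n → + h * altBinomialSum (suc r) h n - altBinomialSum (suc r) h (suc n)
                                      ≡ + suc r * altBinomialSum r (suc h) n
altBinomialSum-recurrence r h n = begin
  + h * sumFrom0 (suc r) (T n) - sumFrom0 (suc r) (T (suc n))
    ≡⟨ cong (_- sumFrom0 (suc r) (T (suc n))) (sumFrom0-*ˡ (suc r) (+ h) (T n)) ⟨
  sumFrom0 (suc r) (λ t → + h * T n t) - sumFrom0 (suc r) (T (suc n))
    ≡⟨ sumFrom0-- (suc r) (λ t → + h * T n t) (T (suc n)) ⟨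
  sumFrom0 (suc r) (λ t → + h * T n t - T (suc n) t)
    ≡⟨ sumFrom0-cong (suc r) difference ⟩
  + 0 + sumFrom1 (suc r) (λ t → - (+ t * T n t))
    ≡⟨ ℤ.+-identityˡ _ ⟩
  sumFrom1 (suc r) (λ t → - (+ t * T n t))
    ≡⟨ sumFrom1-shift r (λ t → - (+ t * T n t)) ⟩
  sumFrom0 r (λ s → - (+ suc s * T n (suc s)))
    ≡⟨ sumFrom0-cong r absorption ⟩
  sumFrom0 r (λ s → + suc r * altBinomialTerm r (suc h) n s)
    ≡⟨ sumFrom0-*ˡ r (+ suc r) (altBinomialTerm r (suc h) n) ⟩
  + suc r * altBinomialSum r (suc h) n ∎
  where
  open ≡-Reasoning
  T : ℕ → ℕ → ℤ
  T = altBinomialTerm (suc r) h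
  difference : ∀ t → + h * T n t - T (suc n) t ≡ - (+ t * T n t)
  difference t = begin
    + h * (sign t * + (c ℕ.* x ^ n)) - sign t * + (c ℕ.* (x ℕ.* x ^ n))
      ≡⟨ cong₂ (λ u v → + h * (sign t * u) - sign t * v) (ℤ.pos-* c (x ^ n)) lift ⟩
    + h * (sign t * (+ c * + (x ^ n))) - sign t * (+ c * ((+ h + + t) * + (x ^ n)))
      ≡⟨ ring (+ h) (+ t) (sign t) (+ c) (+ (x ^ n)) ⟩
    - (+ t * (sign t * (+ c * + (x ^ n))))
      ≡⟨ cong (λ u → - (+ t * (sign t * u))) (ℤ.pos-* c (x ^ n)) ⟨
    - (+ t * (sign t * + (c ℕ.* x ^ n))) ∎
    where
    c = suc r C t
    x = h ℕ.+ t
    lift : + (c ℕ.* (x ℕ.* x ^ n)) ≡ + c * ((+ h + + t) * + (x ^ n))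
    lift = trans (ℤ.pos-* c _) (cong (+ c *_) (trans (ℤ.pos-* x (x ^ n)) (cong (_* + (x ^ n)) (ℤ.pos-+ h t))))
    ring : ∀ h t s c y → h * (s * (c * y)) - s * (c * ((h + t) * y)) ≡ - (t * (s * (c * y)))
    ring = solve-∀
  absorption : ∀ s → - (+ suc s * T n (suc s)) ≡ + suc r * altBinomialTerm r (suc h) n s
  absorption s = begin
    - (+ suc s * ((- sign s) * + ((suc r C suc s) ℕ.* (h ℕ.+ suc s) ^ n)))
      ≡⟨ ring₁ (+ suc s) (sign s) _ ⟩
    sign s * (+ suc s * + ((suc r C suc s) ℕ.* (h ℕ.+ suc s) ^ n))
      ≡⟨ cong (sign s *_) (trans (sym (ℤ.pos-* (suc s) _)) (cong +_ nat)) ⟩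
    sign s * + (suc r ℕ.* ((r C s) ℕ.* (suc h ℕ.+ s) ^ n))
      ≡⟨ cong (sign s *_) (ℤ.pos-* (suc r) _) ⟩
    sign s * (+ suc r * + ((r C s) ℕ.* (suc h ℕ.+ s) ^ n))
      ≡⟨ ring₂ (sign s) (+ suc r) _ ⟩
    + suc r * (sign s * + ((r C s) ℕ.* (suc h ℕ.+ s) ^ n)) ∎
    where
    ring₁ : ∀ a σ y → - (a * ((- σ) * y)) ≡ σ * (a * y)
    ring₁ = solve-∀
    ring₂ : ∀ σ a y → σ * (a * y) ≡ a * (σ * y)
    ring₂ = solve-∀
    nat : suc s ℕ.* ((suc r C suc s) ℕ.* (h ℕ.+ suc s) ^ n) ≡ suc r ℕ.* ((r C s) ℕ.* (suc h ℕ.+ s) ^ n)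
    nat = begin
      suc s ℕ.* ((suc r C suc s) ℕ.* (h ℕ.+ suc s) ^ n)
        ≡⟨ ℕ.*-assoc (suc s) (suc r C suc s) ((h ℕ.+ suc s) ^ n) ⟨
      suc s ℕ.* (suc r C suc s) ℕ.* (h ℕ.+ suc s) ^ n
        ≡⟨ cong₂ (λ u v → u ℕ.* v ^ n) ([1+k]*[1+n]C[1+k]≡[1+n]*nCk r s) (ℕ.+-suc h s) ⟩
      suc r ℕ.* (r C s) ℕ.* (suc h ℕ.+ s) ^ n
        ≡⟨ ℕ.*-assoc (suc r) (r C s) ((suc h ℕ.+ s) ^ n) ⟩
      suc r ℕ.* ((r C s) ℕ.* (suc h ℕ.+ s) ^ n) ∎

alternating-hockey-stick : ∀ n K → sumFrom1 K (λ α → sign α * + ((suc K C suc α) ℕ.* α ^ suc n))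
                                   ≡ sumFrom1 K (λ k → altBinomialSum k 0 (suc n))
alternating-hockey-stick n zero    = refl
alternating-hockey-stick n (suc K) = begin
  sumFrom1 (suc K) (λ α → sign α * + ((suc (suc K) C suc α) ℕ.* α ^ suc n))
    ≡⟨ sumFrom1-cong (suc K) (λ α _ → pascal α) ⟩
  sumFrom1 (suc K) (λ α → T α + g α)
    ≡⟨ sumFrom1-+ (suc K) T g ⟩
  sumFrom1 (suc K) T + (sumFrom1 K g + g (suc K))
    ≡⟨ cong₂ (λ x y → x + (y + g (suc K)))
             (sym (ℤ.+-identityˡ (sumFrom1 (suc K) T))) (alternating-hockey-stick n K) ⟩
  A (suc K) + (sumFrom1 K A + g (suc K))
    ≡⟨ cong (_+_ (A (suc K))) (trans (cong (_+_ (sumFrom1 K A)) last-term≡0) (ℤ.+-identityʳ _)) ⟩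
  A (suc K) + sumFrom1 K A
    ≡⟨ ℤ.+-comm (A (suc K)) _ ⟩
  sumFrom1 (suc K) A ∎
  where
  open ≡-Reasoning
  A : ℕ → ℤ
  A k = altBinomialSum k 0 (suc n)
  T g : ℕ → ℤ
  T = altBinomialTerm (suc K) 0 (suc n)
  g α = sign α * + ((suc K C suc α) ℕ.* α ^ suc n)
  last-term≡0 : g (suc K) ≡ + 0
  last-term≡0 = trans (cong (λ c → sign (suc K) * + (c ℕ.* suc K ^ suc n)) (k>n⇒nCk≡0 (ℕ.n<1+n (suc K))))
                      (ℤ.*-zeroʳ (sign (suc K)))
  pascal : ∀ α → sign α * + ((suc (suc K) C suc α) ℕ.* α ^ suc n) ≡ T α + g α
  pascal α = begin
    sign α * + ((suc (suc K) C suc α) ℕ.* α ^ suc n)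
      ≡⟨ cong (λ c → sign α * + (c ℕ.* α ^ suc n)) (nCk+nC[k+1]≡[n+1]C[k+1] (suc K) α) ⟨
    sign α * + ((suc K C α ℕ.+ suc K C suc α) ℕ.* α ^ suc n)
      ≡⟨ cong (λ x → sign α * + x) (ℕ.*-distribʳ-+ (α ^ suc n) (suc K C α) _) ⟩
    sign α * + ((suc K C α) ℕ.* α ^ suc n ℕ.+ (suc K C suc α) ℕ.* α ^ suc n)
      ≡⟨ cong (sign α *_) (ℤ.pos-+ ((suc K C α) ℕ.* α ^ suc n) _) ⟩
    sign α * (+ ((suc K C α) ℕ.* α ^ suc n) + + ((suc K C suc α) ℕ.* α ^ suc n))
      ≡⟨ ℤ.*-distribˡ-+ (sign α) _ _ ⟩
    T α + g α ∎

image : ∀ {a b} → Vec (Fin a) b → Subset a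
image []      = ⊥
image (i ∷ v) = ⁅ i ⁆ ∪ image v

∈-image⁺ : ∀ {a b} (v : Vec (Fin a) b) j → lookup v j ∈ image v
∈-image⁺ (i ∷ v) zero    = x∈p∪q⁺ (inj₁ (x∈⁅x⁆ i))
∈-image⁺ (i ∷ v) (suc j) = x∈p∪q⁺ (inj₂ (∈-image⁺ v j))

∈-image⁻ : ∀ {a b} (v : Vec (Fin a) b) {x} → x ∈ image v → ∃ λ j → lookup v j ≡ x
∈-image⁻ [] x∈ = contradiction x∈ ∉⊥
∈-image⁻ (i ∷ v) x∈ with x∈p∪q⁻ ⁅ i ⁆ (image v) x∈
... | inj₁ x∈⁅i⁆ = zero , sym (x∈⁅y⁆⇒x≡y i x∈⁅i⁆)
... | inj₂ x∈img = let j , eq = ∈-image⁻ v x∈img in suc j , eq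

surjective⇒∣image∣≡ : ∀ {a b} (v : Vec (Fin a) b) → Surjective v → ∣ image v ∣ ≡ a
surjective⇒∣image∣≡ {a} v surj = trans (cong ∣_∣ image≡⊤) (∣⊤∣≡n a)
  where
  image≡⊤ : image v ≡ ⊤
  image≡⊤ = ⊆-antisym ⊆⊤ λ {y} _ → let j , eq = surj y in subst (_∈ image v) eq (∈-image⁺ v j)

∣image∣≡⇒surjective : ∀ {a b} (v : Vec (Fin a) b) → ∣ image v ∣ ≡ a → Surjective v
∣image∣≡⇒surjective v eq y = ∈-image⁻ v (subst (y ∈_) (sym (∣p∣≡n⇒p≡⊤ eq)) ∈⊤)

transition : ℕ → (ℕ → ℕ) → ℕ → ℕ
transition a F h = h ℕ.* F h ℕ.+ (a ∸ h) ℕ.* F (suc h)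

sum-∣⁅i⁆∪p∣ : ∀ {n} (p : Subset n) (F : ℕ → ℕ) →
              sum (tabulate (λ i → F ∣ ⁅ i ⁆ ∪ p ∣)) ≡ transition n F ∣ p ∣
sum-∣⁅i⁆∪p∣ [] F = refl
sum-∣⁅i⁆∪p∣ (inside ∷ p) F
  rewrite sum-∣⁅i⁆∪p∣ p (F ∘ suc) | ∪-identityˡ p = sym (ℕ.+-assoc (F (suc ∣ p ∣)) _ _)
sum-∣⁅i⁆∪p∣ {suc n} (outside ∷ p) F
  rewrite sum-∣⁅i⁆∪p∣ p F | ∪-identityˡ p | ℕ.+-∸-assoc 1 (∣p∣≤n p)
  = shuffle (F (suc ∣ p ∣)) (∣ p ∣ ℕ.* F ∣ p ∣) (n ∸ ∣ p ∣)
  where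
  shuffle : ∀ x y d → x ℕ.+ (y ℕ.+ d ℕ.* x) ≡ y ℕ.+ (x ℕ.+ d ℕ.* x)
  shuffle = solve-ℕ

sum-map-concatMap : ∀ {A B : Set} (g : B → ℕ) (k : A → List B) xs →
                    sum (map g (concatMap k xs)) ≡ sum (map (sum ∘ map g ∘ k) xs)
sum-map-concatMap g k []       = refl
sum-map-concatMap g k (x ∷ xs) = begin
  sum (map g (k x ++ concatMap k xs))                ≡⟨ cong sum (List.map-++ g (k x) _) ⟩
  sum (map g (k x) ++ map g (concatMap k xs))        ≡⟨ sum-++ (map g (k x)) _ ⟩
  sum (map g (k x)) ℕ.+ sum (map g (concatMap k xs)) ≡⟨ cong (sum (map g (k x)) ℕ.+_) (sum-map-concatMap g k xs) ⟩
  sum (map (sum ∘ map g ∘ k) (x ∷ xs))               ∎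
  where open ≡-Reasoning

sum-∣image∣ : ∀ a b (F : ℕ → ℕ) →
              sum (map (F ∘ ∣_∣ ∘ image) (allFuns a b)) ≡ iterate (transition a) F b 0
sum-∣image∣ a zero    F = trans (ℕ.+-identityʳ _) (cong F (∣⊥∣≡0 a))
sum-∣image∣ a (suc b) F = begin
  sum (map (F ∘ ∣_∣ ∘ image) (concatMap extensions (allFuns a b)))
    ≡⟨ sum-map-concatMap (F ∘ ∣_∣ ∘ image) extensions (allFuns a b) ⟩
  sum (map (sum ∘ map (F ∘ ∣_∣ ∘ image) ∘ extensions) (allFuns a b))
    ≡⟨ cong sum (List.map-cong sum-extensions (allFuns a b)) ⟩
  sum (map (transition a F ∘ ∣_∣ ∘ image) (allFuns a b))
    ≡⟨ sum-∣image∣ a b (transition a F) ⟩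
  iterate (transition a) F (suc b) 0 ∎
  where
  open ≡-Reasoning
  extensions : Vec (Fin a) b → List (Vec (Fin a) (suc b))
  extensions v = map (_∷ v) (allFin a)
  sum-extensions : ∀ v → sum (map (F ∘ ∣_∣ ∘ image) (extensions v)) ≡ transition a F ∣ image v ∣
  sum-extensions v = trans (cong sum (trans (sym (List.map-∘ (allFin a))) (List.map-tabulate (λ i → i) _)))
                           (sum-∣⁅i⁆∪p∣ (image v) F)

length-filter≡sum-map : ∀ {A : Set} {p} {P : Pred A p} (P? : Decidable P) xs →
                        length (filter P? xs) ≡ sum (map (λ x → if does (P? x) then 1 else 0) xs)
length-filter≡sum-map P? []       = refl
length-filter≡sum-map P? (x ∷ xs) with does (P? x)
... | true  = cong suc (length-filter≡sum-map P? xs)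
... | false = length-filter≡sum-map P? xs

δ : ℕ → ℕ → ℕ
δ a h = if does (h ≟ a) then 1 else 0

Sur≡fold-transition : ∀ a b → Sur a b ≡ fold (δ a) (transition a) b 0
Sur≡fold-transition a b = begin
  length (filter surjective? (allFuns a b))
    ≡⟨ cong length (List.filter-≐ surjective? (λ v → ∣ image v ∣ ≟ a)
                     ((λ {v} → surjective⇒∣image∣≡ v) , (λ {v} → ∣image∣≡⇒surjective v)) (allFuns a b)) ⟩
  length (filter (λ v → ∣ image v ∣ ≟ a) (allFuns a b))
    ≡⟨ length-filter≡sum-map (λ v → ∣ image v ∣ ≟ a) (allFuns a b) ⟩
  sum (map (δ a ∘ ∣_∣ ∘ image) (allFuns a b))
    ≡⟨ sum-∣image∣ a b (δ a) ⟩
  iterate (transition a) (δ a) b 0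
    ≡⟨ cong (λ F → F 0) (iterate-is-fold (δ a) (transition a) b) ⟨
  fold (δ a) (transition a) b 0 ∎
  where open ≡-Reasoning

+-transition : ∀ a F h → + transition a F h ≡ + h * + F h + + (a ∸ h) * + F (suc h)
+-transition a F h =
  trans (ℤ.pos-+ (h ℕ.* F h) _) (cong₂ _+_ (ℤ.pos-* h (F h)) (ℤ.pos-* (a ∸ h) (F (suc h))))

-- fold (δ a) (transition a) n h counts the tables of length n whose image, together with
-- h fixed elements of Fin a, is all of Fin a.
fold-transition-δ≡altBinomialSum : ∀ {a} n r h → h ℕ.+ r ≡ a →
                                   + fold (δ a) (transition a) n h ≡ sign r * altBinomialSum r h n
fold-transition-δ≡altBinomialSum {a} zero zero h h+0≡a =
  cong (λ b → + (if b then 1 else 0)) (dec-true (h ≟ a) (trans (sym (ℕ.+-identityʳ h)) h+0≡a))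
fold-transition-δ≡altBinomialSum {a} zero (suc r) h h+r≡a = begin
  + δ a h                                ≡⟨ cong (λ b → + (if b then 1 else 0)) (dec-false (h ≟ a) h≢a) ⟩
  + 0                                    ≡⟨ ℤ.*-zeroʳ (sign (suc r)) ⟨
  sign (suc r) * + 0                     ≡⟨ cong (sign (suc r) *_) (altBinomialSum[1+r,h,0]≡0 r h) ⟨
  sign (suc r) * altBinomialSum (suc r) h 0 ∎
  where
  open ≡-Reasoning
  h≢a : h ≢ a
  h≢a h≡a = ℕ.m≢1+m+n h (trans h≡a (trans (sym h+r≡a) (ℕ.+-suc h r)))
fold-transition-δ≡altBinomialSum {a} (suc n) zero h refl = begin
  + transition a F h
    ≡⟨ +-transition a F h ⟩
  + h * + F h + + (a ∸ h) * + F (suc h)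
    ≡⟨ cong₂ (λ x y → + h * x + + y * + F (suc h))
             (fold-transition-δ≡altBinomialSum n 0 h refl) (ℕ.m+n∸m≡n h 0) ⟩
  + h * (+ 1 * altBinomialSum 0 h n) + + 0
    ≡⟨ trans (ℤ.+-identityʳ _) (cong (+ h *_) (ℤ.*-identityˡ _)) ⟩
  + h * altBinomialSum 0 h n
    ≡⟨ cong (+ h *_) (altBinomialSum[0,h,n]≡h^n h n) ⟩
  + h * + (h ^ n)
    ≡⟨ ℤ.pos-* h (h ^ n) ⟨
  + (h ^ suc n)
    ≡⟨ trans (ℤ.*-identityˡ _) (altBinomialSum[0,h,n]≡h^n h (suc n)) ⟨
  sign 0 * altBinomialSum 0 h (suc n) ∎
  where
  open ≡-Reasoning
  F = fold (δ a) (transition a) n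
fold-transition-δ≡altBinomialSum {a} (suc n) (suc r) h refl = begin
  + transition a F h
    ≡⟨ +-transition a F h ⟩
  + h * + F h + + (a ∸ h) * + F (suc h)
    ≡⟨ cong₃ (fold-transition-δ≡altBinomialSum n (suc r) h refl) (ℕ.m+n∸m≡n h (suc r))
             (fold-transition-δ≡altBinomialSum n r (suc h) (sym (ℕ.+-suc h r))) ⟩
  + h * ((- sign r) * S (suc r) h n) + + suc r * (sign r * S r (suc h) n)
    ≡⟨ cong (_+_ (+ h * ((- sign r) * S (suc r) h n))) (trans (swap (+ suc r) (sign r) _)
         (cong (sign r *_) (sym (altBinomialSum-recurrence r h n)))) ⟩
  + h * ((- sign r) * S (suc r) h n) + sign r * (+ h * S (suc r) h n - S (suc r) h (suc n))
    ≡⟨ cancel (+ h) (sign r) (S (suc r) h n) (S (suc r) h (suc n)) ⟩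
  sign (suc r) * altBinomialSum (suc r) h (suc n) ∎
  where
  open ≡-Reasoning
  F = fold (δ a) (transition a) n
  S = altBinomialSum
  swap : ∀ a b c → a * (b * c) ≡ b * (a * c)
  swap = solve-∀
  cancel : ∀ h s x y → h * ((- s) * x) + s * (h * x - y) ≡ (- s) * y
  cancel = solve-∀
  cong₃ : ∀ {x x' y y' z z'} → x ≡ x' → y ≡ y' → z ≡ z' → + h * x + + y * z ≡ + h * x' + + y' * z'
  cong₃ refl refl refl = refl

Sur≡altBinomialSum : ∀ a n → + Sur a n ≡ sign a * altBinomialSum a 0 n
Sur≡altBinomialSum a n = trans (cong +_ (Sur≡fold-transition a n)) (fold-transition-δ≡altBinomialSum n a 0 refl)

f-suc : ∀ K n → f (suc K) n ≡ sign K * sumFrom1 K (λ α → sign α * + ((suc K C suc α) ℕ.* α ^ n))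
f-suc K n = trans (sumFrom1-cong K (λ α _ → term α)) (sumFrom1-*ˡ K (sign K) _)
  where
  term : ∀ α → sign (suc K ℕ.+ α ℕ.+ 1) * + ((suc K C suc α) ℕ.* α ^ n)
             ≡ sign K * (sign α * + ((suc K C suc α) ℕ.* α ^ n))
  term α = begin
    sign (suc K ℕ.+ α ℕ.+ 1) * x ≡⟨ cong (λ y → sign (suc y) * x) (ℕ.+-comm (K ℕ.+ α) 1) ⟩
    - - sign (K ℕ.+ α) * x       ≡⟨ cong (_* x) (ℤ.neg-involutive (sign (K ℕ.+ α))) ⟩
    sign (K ℕ.+ α) * x           ≡⟨ cong (_* x) (sign-+ K α) ⟩
    sign K * sign α * x          ≡⟨ ℤ.*-assoc (sign K) (sign α) x ⟩
    sign K * (sign α * x)        ∎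
    where
    open ≡-Reasoning
    x = + ((suc K C suc α) ℕ.* α ^ n)

proposition2p2 : (m n : ℕ) → 2 ≤ m → m ≤ n →
    f m n ≡ sumFrom1 (m ∸ 1) (λ k → sign (m ∸ 1 ∸ k) * + Sur k n)
proposition2p2 (suc (suc M)) (suc n) _ _ = begin
  f (suc K) (suc n)
    ≡⟨ f-suc K (suc n) ⟩
  sign K * sumFrom1 K (λ α → sign α * + ((suc K C suc α) ℕ.* α ^ suc n))
    ≡⟨ cong (sign K *_) (alternating-hockey-stick n K) ⟩
  sign K * sumFrom1 K (λ k → altBinomialSum k 0 (suc n))
    ≡⟨ sumFrom1-*ˡ K (sign K) _ ⟨
  sumFrom1 K (λ k → sign K * altBinomialSum k 0 (suc n))
    ≡⟨ sumFrom1-cong K (λ k k≤K → trans (cong (_* _) (sign-∸ k≤K)) (ℤ.*-assoc (sign (K ∸ k)) (sign k) _)) ⟩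
  sumFrom1 K (λ k → sign (K ∸ k) * (sign k * altBinomialSum k 0 (suc n)))
    ≡⟨ sumFrom1-cong K (λ k _ → cong (sign (K ∸ k) *_) (Sur≡altBinomialSum k (suc n))) ⟨
  sumFrom1 K (λ k → sign (K ∸ k) * + Sur k (suc n)) ∎
  where
  open ≡-Reasoning
  K = suc M
proposition2p2 (suc (suc M)) zero _ ()
proposition2p2 (suc zero) _ (ℕ.s≤s ()) _
proposition2p2 zero _ () _
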